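{- Let $\mathcal{M}$ be a cartesian category, acting on itself via the cartesian product, and let $F:\mathcal{M}\to\mathcal{M}$ be any endofunctor. Then the cofree copointed functor over $F$, namely $\mathsf{id}_{\mathcal{M}}\times F: X\mapsto X\times F(X)$ (with copoint the first projection), is costrong.
   Context: A costrong endofunctor on $\mathcal{M}$ (for the action of $(\mathcal{M},\times,\mathbb{1})$ on itself by $\times$) is a functor $G:\mathcal{M}\to\mathcal{M}$ with a natural transformation $\mathsf{cst}_{M,X}:G(M\times X)\to M\times G(X)$ such that (writing associativity and unit isomorphisms of $\times$ unlabelled) $\mathsf{cst}_{M\times N,X}\circ G(\cong)=\cong\circ(\mathsf{id}_M\times\mathsf{cst}_{N,X})\circ\mathsf{cst}_{M,N\times X}$ as maps $G(M\times(N\times X))\to(M\times N)\times G(X)$, and $G(\mathbb{1}\times X)\xrightarrow{\mathsf{cst}}\mathbb{1}\times G(X)\cong G(X)$ equals $G(\mathbb{1}\times X\cong X)$. A copointed endofunctor is a functor $G$ with a natural transformation $G\to\mathsf{id}_{\mathcal{M}}$. -}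

module Defs where

open import Level using (Level; _⊔_) renaming (suc to lsuc)
open import Relation.Binary using (Rel; IsEquivalence; Setoid)
import Relation.Binary.Reasoning.Setoid as SetoidR

record Category (o ℓ e : Level) : Set (lsuc (o ⊔ ℓ ⊔ e)) where
  infixr 9 _∘_
  infix  4 _≈_
  infixr 0 _⇒_
  field
    Obj       : Set o
    _⇒_       : Obj → Obj → Set ℓ
    _≈_       : ∀ {A B} → Rel (A ⇒ B) e
    id        : ∀ {A} → A ⇒ A
    _∘_       : ∀ {A B C} → B ⇒ C → A ⇒ B → A ⇒ C
    equiv     : ∀ {A B} → IsEquivalence (_≈_ {A} {B})
    assoc     : ∀ {A B C D} {f : A ⇒ B} {g : B ⇒ C} {h : C ⇒ D} →
                (h ∘ g) ∘ f ≈ h ∘ (g ∘ f)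
    identityˡ : ∀ {A B} {f : A ⇒ B} → id ∘ f ≈ f
    identityʳ : ∀ {A B} {f : A ⇒ B} → f ∘ id ≈ f
    ∘-resp-≈  : ∀ {A B C} {f h : B ⇒ C} {g i : A ⇒ B} →
                f ≈ h → g ≈ i → f ∘ g ≈ h ∘ i

  hom-setoid : ∀ {A B} → Setoid ℓ e
  hom-setoid {A} {B} = record { Carrier = A ⇒ B ; _≈_ = _≈_ ; isEquivalence = equiv }

record Functor {o ℓ e} (C D : Category o ℓ e) : Set (o ⊔ ℓ ⊔ e) where
  private
    module C = Category C
    module D = Category D
  field
    F₀           : C.Obj → D.Obj
    F₁           : ∀ {A B} → C._⇒_ A B → D._⇒_ (F₀ A) (F₀ B)
    identity     : ∀ {A} → F₁ (C.id {A}) D.≈ D.id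
    homomorphism : ∀ {X Y Z} {f : C._⇒_ X Y} {g : C._⇒_ Y Z} →
                   F₁ (g C.∘ f) D.≈ (F₁ g D.∘ F₁ f)
    F-resp-≈     : ∀ {A B} {f g : C._⇒_ A B} → f C.≈ g → F₁ f D.≈ F₁ g

record Cartesian {o ℓ e} (C : Category o ℓ e) : Set (o ⊔ ℓ ⊔ e) where
  open Category C
  infixr 7 _×_
  field
    ⊤        : Obj
    !        : ∀ {A} → A ⇒ ⊤
    !-unique : ∀ {A} (f : A ⇒ ⊤) → ! ≈ f
    _×_      : Obj → Obj → Obj
    π₁       : ∀ {A B} → A × B ⇒ A
    π₂       : ∀ {A B} → A × B ⇒ B
    ⟨_,_⟩    : ∀ {A B C} → C ⇒ A → C ⇒ B → C ⇒ A × B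
    project₁ : ∀ {A B C} {f : C ⇒ A} {g : C ⇒ B} → π₁ ∘ ⟨ f , g ⟩ ≈ f
    project₂ : ∀ {A B C} {f : C ⇒ A} {g : C ⇒ B} → π₂ ∘ ⟨ f , g ⟩ ≈ g
    unique   : ∀ {A B C} {h : C ⇒ A × B} {f : C ⇒ A} {g : C ⇒ B} →
               π₁ ∘ h ≈ f → π₂ ∘ h ≈ g → ⟨ f , g ⟩ ≈ h

module CartesianKit {o ℓ e} {C : Category o ℓ e} (Ca : Cartesian C) where
  open Category C
  open Cartesian Ca
  private
    module E {A B} = IsEquivalence (equiv {A} {B})

  infixr 8 _⁂_
  _⁂_ : ∀ {A B A' B'} → A ⇒ A' → B ⇒ B' → A × B ⇒ A' × B'
  f ⁂ g = ⟨ f ∘ π₁ , g ∘ π₂ ⟩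

  α⇒ : ∀ {M N X} → M × (N × X) ⇒ (M × N) × X
  α⇒ = ⟨ ⟨ π₁ , π₁ ∘ π₂ ⟩ , π₂ ∘ π₂ ⟩

  λ⇒ : ∀ {X} → ⊤ × X ⇒ X
  λ⇒ = π₂

  ⟨⟩-cong : ∀ {A B D} {f f' : D ⇒ A} {g g' : D ⇒ B} →
            f ≈ f' → g ≈ g' → ⟨ f , g ⟩ ≈ ⟨ f' , g' ⟩
  ⟨⟩-cong {f = f} {f'} {g} {g'} p q =
    E.sym (unique (E.trans project₁ p) (E.trans project₂ q))

  ⁂-id : ∀ {A B} → id {A} ⁂ id {B} ≈ id
  ⁂-id = unique (E.trans identityʳ (E.sym identityˡ)) (E.trans identityʳ (E.sym identityˡ))

  ⁂-∘ : ∀ {A B A' B' A'' B''} {f : A ⇒ A'} {g : B ⇒ B'} {f' : A' ⇒ A''} {g' : B' ⇒ B''} →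
        (f' ∘ f) ⁂ (g' ∘ g) ≈ (f' ⁂ g') ∘ (f ⁂ g)
  ⁂-∘ {A} {B} {A'} {B'} {A''} {B''} {f} {g} {f'} {g'} = unique l r
    where
    l : π₁ ∘ ((f' ⁂ g') ∘ (f ⁂ g)) ≈ (f' ∘ f) ∘ π₁
    l = let open SetoidR (hom-setoid {A × B} {A''}) in begin
      π₁ ∘ ((f' ⁂ g') ∘ (f ⁂ g)) ≈⟨ E.sym assoc ⟩
      (π₁ ∘ (f' ⁂ g')) ∘ (f ⁂ g) ≈⟨ ∘-resp-≈ project₁ E.refl ⟩
      (f' ∘ π₁) ∘ (f ⁂ g)        ≈⟨ assoc ⟩
      f' ∘ (π₁ ∘ (f ⁂ g))        ≈⟨ ∘-resp-≈ E.refl project₁ ⟩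
      f' ∘ (f ∘ π₁)              ≈⟨ E.sym assoc ⟩
      (f' ∘ f) ∘ π₁              ∎
    r : π₂ ∘ ((f' ⁂ g') ∘ (f ⁂ g)) ≈ (g' ∘ g) ∘ π₂
    r = let open SetoidR (hom-setoid {A × B} {B''}) in begin
      π₂ ∘ ((f' ⁂ g') ∘ (f ⁂ g)) ≈⟨ E.sym assoc ⟩
      (π₂ ∘ (f' ⁂ g')) ∘ (f ⁂ g) ≈⟨ ∘-resp-≈ project₂ E.refl ⟩
      (g' ∘ π₂) ∘ (f ⁂ g)        ≈⟨ assoc ⟩
      g' ∘ (π₂ ∘ (f ⁂ g))        ≈⟨ ∘-resp-≈ E.refl project₂ ⟩
      g' ∘ (g ∘ π₂)              ≈⟨ E.sym assoc ⟩
      (g' ∘ g) ∘ π₂              ∎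

  ⁂-cong : ∀ {A B A' B'} {f f' : A ⇒ A'} {g g' : B ⇒ B'} →
           f ≈ f' → g ≈ g' → f ⁂ g ≈ f' ⁂ g'
  ⁂-cong p q = ⟨⟩-cong (∘-resp-≈ p E.refl) (∘-resp-≈ q E.refl)

record Costrong {o ℓ e} {C : Category o ℓ e} (Ca : Cartesian C)
                (G : Functor C C) : Set (o ⊔ ℓ ⊔ e) where
  open Category C
  open Cartesian Ca
  open CartesianKit Ca
  open Functor G renaming (F₀ to G₀; F₁ to G₁)
  field
    cst       : ∀ M X → G₀ (M × X) ⇒ M × G₀ X
    natural   : ∀ {M M' X X'} (f : M ⇒ M') (g : X ⇒ X') →
                cst M' X' ∘ G₁ (f ⁂ g) ≈ (f ⁂ G₁ g) ∘ cst M X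
    assoc-law : ∀ M N X →
                cst (M × N) X ∘ G₁ (α⇒ {M} {N} {X})
                  ≈ α⇒ ∘ ((id ⁂ cst N X) ∘ cst M (N × X))
    unit-law  : ∀ X → λ⇒ ∘ cst ⊤ X ≈ G₁ (λ⇒ {X})

record Copointed {o ℓ e} (C : Category o ℓ e) : Set (o ⊔ ℓ ⊔ e) where
  open Category C
  field
    functor  : Functor C C
  open Functor functor
  field
    ε        : ∀ X → F₀ X ⇒ X
    ε-natural : ∀ {X Y} (f : X ⇒ Y) → ε Y ∘ F₁ f ≈ f ∘ ε X

module _ {o ℓ e} {C : Category o ℓ e} (Ca : Cartesian C) (F : Functor C C) where
  open Category C
  open Cartesian Ca
  open CartesianKit Ca
  private
    module F = Functor F
    module E {A B} = IsEquivalence (equiv {A} {B})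

  idTimes : Functor C C
  idTimes = record
    { F₀ = λ X → X × F.F₀ X
    ; F₁ = λ f → f ⁂ F.F₁ f
    ; identity = E.trans (⁂-cong E.refl F.identity) ⁂-id
    ; homomorphism = E.trans (⁂-cong E.refl F.homomorphism) ⁂-∘
    ; F-resp-≈ = λ p → ⁂-cong p (F.F-resp-≈ p)
    }

  cofreeCopointed : Copointed C
  cofreeCopointed = record
    { functor = idTimes
    ; ε = λ X → π₁
    ; ε-natural = λ f → project₁
    }

{-# OPTIONS --safe #-}
-- In a cartesian category every copointed endofunctor (G, ε) is costrong: the
-- costrength G (M × X) ⇒ M × G X takes its M-component from the copoint,
-- π₁ ∘ ε, and its G X-component is G π₂.  Naturality of ε moves the
-- projections across G, and that is all the coherence laws need.
module Submission where

open import Relation.Binary using (IsEquivalence)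
import Relation.Binary.Reasoning.Setoid as SetoidR
open import Defs

module HomReasoning {o ℓ e} (C : Category o ℓ e) where
  open Category C

  module _ {A B : Obj} where
    open IsEquivalence (equiv {A} {B}) public using (refl; sym; trans)
    open SetoidR (hom-setoid {A} {B}) public

  ∘-resp-≈ˡ : ∀ {A B D} {f h : B ⇒ D} {g : A ⇒ B} → f ≈ h → f ∘ g ≈ h ∘ g
  ∘-resp-≈ˡ p = ∘-resp-≈ p refl

  ∘-resp-≈ʳ : ∀ {A B D} {f : B ⇒ D} {g i : A ⇒ B} → g ≈ i → f ∘ g ≈ f ∘ i
  ∘-resp-≈ʳ q = ∘-resp-≈ refl q

module CartesianProperties {o ℓ e} {C : Category o ℓ e} (Ca : Cartesian C) where
  open Category C
  open Cartesian Ca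
  open CartesianKit Ca
  open HomReasoning C

  ⟨⟩∘ : ∀ {A B D D'} {f : D ⇒ A} {g : D ⇒ B} {h : D' ⇒ D} →
        ⟨ f , g ⟩ ∘ h ≈ ⟨ f ∘ h , g ∘ h ⟩
  ⟨⟩∘ = sym (unique (trans (sym assoc) (∘-resp-≈ˡ project₁))
                    (trans (sym assoc) (∘-resp-≈ˡ project₂)))

  ⁂∘⟨⟩ : ∀ {A B A' B' D} {f : A ⇒ A'} {g : B ⇒ B'} {a : D ⇒ A} {b : D ⇒ B} →
         (f ⁂ g) ∘ ⟨ a , b ⟩ ≈ ⟨ f ∘ a , g ∘ b ⟩
  ⁂∘⟨⟩ = trans ⟨⟩∘ (⟨⟩-cong (trans assoc (∘-resp-≈ʳ project₁))
                            (trans assoc (∘-resp-≈ʳ project₂)))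

  α⇒∘⟨⟩ : ∀ {M N X D} {a : D ⇒ M} {b : D ⇒ N} {c : D ⇒ X} →
          α⇒ ∘ ⟨ a , ⟨ b , c ⟩ ⟩ ≈ ⟨ ⟨ a , b ⟩ , c ⟩
  α⇒∘⟨⟩ {N = N} {X} {D} {a} {b} {c} = begin
    α⇒ ∘ ⟨ a , ⟨ b , c ⟩ ⟩
      ≈⟨ ⟨⟩∘ ⟩
    ⟨ ⟨ π₁ , π₁ ∘ π₂ ⟩ ∘ ⟨ a , ⟨ b , c ⟩ ⟩ , (π₂ ∘ π₂) ∘ ⟨ a , ⟨ b , c ⟩ ⟩ ⟩
      ≈⟨ ⟨⟩-cong (trans ⟨⟩∘ (⟨⟩-cong project₁ (after-π₂ project₁))) (after-π₂ project₂) ⟩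
    ⟨ ⟨ a , b ⟩ , c ⟩
      ∎
    where
    after-π₂ : ∀ {Y} {p : N × X ⇒ Y} {q : D ⇒ Y} → p ∘ ⟨ b , c ⟩ ≈ q →
               (p ∘ π₂) ∘ ⟨ a , ⟨ b , c ⟩ ⟩ ≈ q
    after-π₂ r = trans assoc (trans (∘-resp-≈ʳ project₂) r)

module FunctorProperties {o ℓ e} {C : Category o ℓ e} (G : Functor C C) where
  open Category C
  open Functor G
  open HomReasoning C

  F₁-square : ∀ {A B B' D} {h : A ⇒ B} {k : B ⇒ D} {k' : A ⇒ B'} {h' : B' ⇒ D} →
              k ∘ h ≈ h' ∘ k' → F₁ k ∘ F₁ h ≈ F₁ h' ∘ F₁ k'
  F₁-square sq = trans (sym homomorphism) (trans (F-resp-≈ sq) homomorphism)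

module CopointedProperties {o ℓ e} {C : Category o ℓ e} (G : Copointed C) where
  open Category C
  open Copointed G
  open Functor functor
  open HomReasoning C

  ∘ε-natural : ∀ {A B D} (f : B ⇒ D) (h : A ⇒ B) → (f ∘ ε B) ∘ F₁ h ≈ (f ∘ h) ∘ ε A
  ∘ε-natural f h = begin
    (f ∘ ε _) ∘ F₁ h  ≈⟨ assoc ⟩
    f ∘ (ε _ ∘ F₁ h)  ≈⟨ ∘-resp-≈ʳ (ε-natural h) ⟩
    f ∘ (h ∘ ε _)     ≈⟨ sym assoc ⟩
    (f ∘ h) ∘ ε _     ∎

module CopointedCostrong {o ℓ e} {C : Category o ℓ e} (Ca : Cartesian C) (G : Copointed C) where
  open Category C
  open Cartesian Ca
  open CartesianKit Ca
  open CartesianProperties Ca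
  open Copointed G
  open Functor functor renaming (F₀ to G₀; F₁ to G₁)
  open FunctorProperties functor renaming (F₁-square to G₁-square)
  open CopointedProperties G
  open HomReasoning C

  cst : ∀ M X → G₀ (M × X) ⇒ M × G₀ X
  cst M X = ⟨ π₁ ∘ ε (M × X) , G₁ π₂ ⟩

  natural : ∀ {M M' X X'} (f : M ⇒ M') (g : X ⇒ X') →
            cst M' X' ∘ G₁ (f ⁂ g) ≈ (f ⁂ G₁ g) ∘ cst M X
  natural f g = begin
    cst _ _ ∘ G₁ (f ⁂ g)                              ≈⟨ ⟨⟩∘ ⟩
    ⟨ (π₁ ∘ ε _) ∘ G₁ (f ⁂ g) , G₁ π₂ ∘ G₁ (f ⁂ g) ⟩  ≈⟨ ⟨⟩-cong π₁-component (G₁-square project₂) ⟩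
    ⟨ f ∘ (π₁ ∘ ε _) , G₁ g ∘ G₁ π₂ ⟩                 ≈⟨ sym ⁂∘⟨⟩ ⟩
    (f ⁂ G₁ g) ∘ cst _ _                              ∎
    where
    π₁-component : (π₁ ∘ ε _) ∘ G₁ (f ⁂ g) ≈ f ∘ (π₁ ∘ ε _)
    π₁-component = trans (∘ε-natural π₁ (f ⁂ g)) (trans (∘-resp-≈ˡ project₁) assoc)

  assoc-law : ∀ M N X →
              cst (M × N) X ∘ G₁ (α⇒ {M} {N} {X})
                ≈ α⇒ ∘ ((id ⁂ cst N X) ∘ cst M (N × X))
  assoc-law M N X = begin
    cst (M × N) X ∘ G₁ α⇒
      ≈⟨ ⟨⟩∘ ⟩
    ⟨ (π₁ ∘ ε _) ∘ G₁ α⇒ , G₁ π₂ ∘ G₁ α⇒ ⟩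
      ≈⟨ ⟨⟩-cong π₁-component (G₁-square project₂) ⟩
    ⟨ ⟨ π₁ ∘ ε _ , (π₁ ∘ ε _) ∘ G₁ π₂ ⟩ , G₁ π₂ ∘ G₁ π₂ ⟩
      ≈⟨ sym α⇒∘⟨⟩ ⟩
    α⇒ ∘ ⟨ π₁ ∘ ε _ , ⟨ (π₁ ∘ ε _) ∘ G₁ π₂ , G₁ π₂ ∘ G₁ π₂ ⟩ ⟩
      ≈⟨ ∘-resp-≈ʳ (⟨⟩-cong (sym identityˡ) (sym ⟨⟩∘)) ⟩
    α⇒ ∘ ⟨ id ∘ (π₁ ∘ ε _) , cst N X ∘ G₁ π₂ ⟩
      ≈⟨ ∘-resp-≈ʳ (sym ⁂∘⟨⟩) ⟩
    α⇒ ∘ ((id ⁂ cst N X) ∘ cst M (N × X))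
      ∎
    where
    π₁-component : (π₁ ∘ ε _) ∘ G₁ α⇒ ≈ ⟨ π₁ ∘ ε _ , (π₁ ∘ ε _) ∘ G₁ π₂ ⟩
    π₁-component = begin
      (π₁ ∘ ε _) ∘ G₁ α⇒                 ≈⟨ ∘ε-natural π₁ α⇒ ⟩
      (π₁ ∘ α⇒) ∘ ε _                    ≈⟨ trans (∘-resp-≈ˡ project₁) ⟨⟩∘ ⟩
      ⟨ π₁ ∘ ε _ , (π₁ ∘ π₂) ∘ ε _ ⟩     ≈⟨ ⟨⟩-cong refl (sym (∘ε-natural π₁ π₂)) ⟩
      ⟨ π₁ ∘ ε _ , (π₁ ∘ ε _) ∘ G₁ π₂ ⟩  ∎

  unit-law : ∀ X → λ⇒ ∘ cst ⊤ X ≈ G₁ (λ⇒ {X})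
  unit-law _ = project₂

  costrong : Costrong Ca functor
  costrong = record
    { cst = cst ; natural = natural ; assoc-law = assoc-law ; unit-law = unit-law }

mainTheorem4 : ∀ {o ℓ e} {C : Category o ℓ e} (Ca : Cartesian C) (F : Functor C C) →
    Costrong Ca (Copointed.functor (cofreeCopointed Ca F))
mainTheorem4 Ca F = CopointedCostrong.costrong Ca (cofreeCopointed Ca F)
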